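{- Let $G$ be a $3$-edge-connected undirected graph (possibly with multiple edges) and $T$ a DFS spanning tree of $G$ rooted at $r$. Let $u,v$ be two vertices such that $u$ is a descendant of $v$ and $B(v)=B(u)\sqcup\{e\}$ for a back-edge $e=(x,y)$. Then $M(u)\in\{\tilde{M}(v),M_{low1}(v),M_{low2}(v)\}$. More precisely, either (1) $M(u)=\tilde{M}(v)$ and $e=(M(v),l_1(M(v)))$, or (2) $M(u)=M_{low1}(v)$ and $e=(M_{low2}(v),l_1(M_{low2}(v)))$, or (3) $M(u)=M_{low2}(v)$ and $e=(M_{low1}(v),l_1(M_{low1}(v)))$.
   Context: Vertices are identified with their DFS preorder numbers. A vertex $u$ is an ancestor of $v$ ($v$ a descendant of $u$) if the tree path from $r$ to $v$ contains $u$ (every vertex is an ancestor and descendant of itself). $T(v)$ denotes the set of descendants of $v$. Non-tree edges are back-edges; a back-edge is written $(x,y)$ with $x$ a descendant of $y$. $B(v)$ is the set of back-edges $(x,y)$ with $x$ a descendant of $v$ and $y$ a proper ancestor of $v$; $\sqcup$ denotes disjoint union. $l_1(v)$ is the smallest $y$ such that there is a back-edge $(v,y)$, or $v$ if there is no such back-edge. For $v\neq r$, $\mathit{low1}(v)=\min\{y:\exists (x,y)\in B(v)\}$. The children of a vertex $w$ sorted in non-decreasing order of $\mathit{low1}$ are $c_1(w),c_2(w),\dots$ (ties broken arbitrarily but fixed; $c_i(w)=\emptyset$ if $w$ has fewer than $i$ children); $c_1(w)$ and $c_2(w)$ are called the $\mathit{low1}$ and $\mathit{low2}$ child of $w$.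 $\mathit{nca}$ denotes nearest common ancestor in $T$. $M(v)=\mathit{nca}\{x:\exists(x,y)\in B(v)\}$; $\tilde M(v)=\mathit{nca}\{x:\exists(x,y)\in B(v),\ x \text{ a proper descendant of } M(v)\}$; $M_{low1}(v)=\mathit{nca}\{x:\exists(x,y)\in B(v),\ x\in T(c_1(M(v)))\}$; $M_{low2}(v)=\mathit{nca}\{x:\exists(x,y)\in B(v),\ x\in T(c_2(M(v)))\}$ (each undefined if the set is empty). -}

module Defs where

open import Data.Nat using (ℕ; suc; _≤_; _≤ᵇ_)
open import Data.Fin using (Fin; zero; suc; toℕ)
open import Data.Product using (Σ; ∃; _×_; _,_; proj₁; proj₂)
open import Data.Sum using (_⊎_)
open import Data.Bool using (if_then_else_)
open import Data.Maybe using (Maybe; just; nothing)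
open import Data.List using (List; length)
open import Data.List.Membership.Propositional using (_∉_)
open import Relation.Binary.PropositionalEquality using (_≡_; _≢_)
open import Relation.Nullary using (¬_)

-- Undirected multigraph with vertex set Fin (suc k) (vertices are the DFS
-- preorder numbers; the root r is 0) and m edges; edge j has the two
-- (unordered) endpoints E j.

Edges : ℕ → ℕ → Set
Edges k m = Fin m → Fin (suc k) × Fin (suc k)

data Reach {k m : ℕ} (E : Edges k m) (ok : Fin m → Set) (a : Fin (suc k)) :
           Fin (suc k) → Set where
  here : Reach E ok a a
  fwd  : (j : Fin m) → ok j → Reach E ok a (proj₁ (E j)) → Reach E ok a (proj₂ (E j))
  bwd  : (j : Fin m) → ok j → Reach E ok a (proj₂ (E j)) → Reach E ok a (proj₁ (E j))

ThreeEdgeConnected : {k m : ℕ} → Edges k m → Set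
ThreeEdgeConnected {k} {m} E =
  (S : List (Fin m)) → length S ≤ 2 → (a b : Fin (suc k)) → Reach E (λ j → j ∉ S) a b

-- Rooted tree on Fin (suc k), root 0: non-root vertex suc i has parent par i.
-- Anc par u v : u is an ancestor of v (reflexive).
data Anc {k : ℕ} (par : Fin k → Fin (suc k)) (u : Fin (suc k)) : Fin (suc k) → Set where
  refl : Anc par u u
  up   : ∀ {i} → Anc par u (par i) → Anc par u (suc i)

record DFSTree {k m : ℕ} (E : Edges k m) : Set where
  field
    parent    : Fin k → Fin (suc k)
    parent<   : ∀ i → toℕ (parent i) ≤ toℕ i       -- i.e. parent(suc i) < suc i
    tedge     : Fin k → Fin m
    tedge-inj : ∀ i i' → tedge i ≡ tedge i' → i ≡ i'
    tedge-end : ∀ i → (E (tedge i) ≡ (suc i , parent i)) ⊎ (E (tedge i) ≡ (parent i , suc i))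
    back-anc  : ∀ j → (∀ i → tedge i ≢ j) →
                Anc parent (proj₁ (E j)) (proj₂ (E j)) ⊎ Anc parent (proj₂ (E j)) (proj₁ (E j))
    -- the numbering is a preorder numbering of T: every T(v) is an interval starting at v
    preorder  : ∀ v w z → Anc parent v z → toℕ v ≤ toℕ w → toℕ w ≤ toℕ z → Anc parent v w

module _ {k m : ℕ} {E : Edges k m} (tr : DFSTree E) where
  open DFSTree tr

  V : Set
  V = Fin (suc k)

  _≼_ : V → V → Set
  u ≼ v = Anc parent u v

  IsBack : Fin m → Set
  IsBack j = ∀ i → tedge i ≢ j

  -- back-edge j written (x j , y j) with x j a descendant of y j
  -- (the ancestor has the smaller preorder number)
  x : Fin m → V
  x j = if toℕ (proj₁ (E j)) ≤ᵇ toℕ (proj₂ (E j)) then proj₂ (E j) else proj₁ (E j)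

  y : Fin m → V
  y j = if toℕ (proj₁ (E j)) ≤ᵇ toℕ (proj₂ (E j)) then proj₁ (E j) else proj₂ (E j)

  InB : V → Fin m → Set
  InB v j = IsBack j × (v ≼ x j) × (y j ≼ v) × (y j ≢ v)

  Child : V → V → Set
  Child c w = Σ (Fin k) λ i → (c ≡ suc i) × (parent i ≡ w)

  IsNCA : (V → Set) → V → Set
  IsNCA S z = (Σ V S) × (∀ a → S a → z ≼ a) × (∀ z' → (∀ a → S a → z' ≼ a) → z' ≼ z)

  IsL1 : V → V → Set
  IsL1 v w =
    (Σ (Fin m) λ j → IsBack j × x j ≡ v × y j ≡ w ×
       (∀ j' → IsBack j' → x j' ≡ v → toℕ w ≤ toℕ (y j')))
    ⊎ ((∀ j → IsBack j → x j ≢ v) × w ≡ v)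

  IsLow1 : V → V → Set
  IsLow1 c l = (Σ (Fin m) λ j → InB c j × y j ≡ l) × (∀ j → InB c j → toℕ l ≤ toℕ (y j))

  Low1≤ : V → V → Set
  Low1≤ c c' = ∀ l l' → IsLow1 c l → IsLow1 c' l' → toℕ l ≤ toℕ l'

  -- the first two children c₁(w), c₂(w) in a fixed order of the children of
  -- w sorted by non-decreasing low1 (ties broken arbitrarily)
  record ChildOrder : Set where
    field
      c₁ c₂     : V → Maybe V
      c₁-just    : ∀ w c → c₁ w ≡ just c → Child c w × (∀ c' → Child c' w → Low1≤ c c')
      c₁-nothing : ∀ w → c₁ w ≡ nothing → ∀ c → ¬ Child c w
      c₂-just    : ∀ w c → c₂ w ≡ just c → Child c w ×
                   (Σ V λ d → c₁ w ≡ just d × c ≢ d × (∀ c' → Child c' w → c' ≢ d → Low1≤ c c'))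
      c₂-nothing : ∀ w → c₂ w ≡ nothing → ∀ c d → c₁ w ≡ just d → Child c w → c ≡ d

  IsM : V → V → Set
  IsM v z = IsNCA (λ a → Σ (Fin m) λ j → InB v j × x j ≡ a) z

  IsMt : V → V → Set
  IsMt v z = Σ V λ Mv → IsM v Mv ×
    IsNCA (λ a → Σ (Fin m) λ j → InB v j × x j ≡ a × Mv ≼ a × a ≢ Mv) z

  module _ (ord : ChildOrder) where
    open ChildOrder ord

    IsMlow1 : V → V → Set
    IsMlow1 v z = Σ V λ Mv → Σ V λ c → IsM v Mv × c₁ Mv ≡ just c ×
      IsNCA (λ a → Σ (Fin m) λ j → InB v j × x j ≡ a × c ≼ a) z

    IsMlow2 : V → V → Set
    IsMlow2 v z = Σ V λ Mv → Σ V λ c → IsM v Mv × c₂ Mv ≡ just c ×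
      IsNCA (λ a → Σ (Fin m) λ j → InB v j × x j ≡ a × c ≼ a) z

{-# OPTIONS --safe #-}
module Submission where

-- Call x_j the descendant endpoint ("tip") of a back-edge j. Since B(v) = B(u) ⊔ {e} and
-- x_e ∉ T(u), the tips of B(u) lie below M(u) ⊒ M(v), while x_e lies below M(v) but not below
-- M(u). If x_e = M(v), the tips strictly below M(v) are exactly those of B(u), so M(u) = M̃(v).
-- Otherwise M(u) and x_e lie below distinct children c, c' of M(v), both with low1 < v. A
-- back-edge from any other child of M(v) jumping over v would be in B(v) without being in B(u)
-- or equal to e, so c and c' are the low1 and low2 children of M(v), and M(u), x_e are the nca's
-- of the tips of B(v) below c and c' respectively. In all cases l₁(x_e) = y_e: a lower
-- back-edge from x_e would again be in B(v) but neither in B(u) nor e.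

open import Defs
open import Data.Nat using (ℕ; zero; suc; _≤_; _<_; _≤ᵇ_; s≤s; z≤n)
open import Data.Nat.Properties
  using (≤-refl; ≤-trans; ≤-antisym; ≤-total; ≤∧≢⇒<; <⇒≱; 1+n≰n; n≤1+n; ≤-<-trans; ≤ᵇ⇒≤; ≤⇒≤ᵇ)
open import Data.Fin using (Fin; zero; suc; toℕ)
open import Data.Fin.Properties using (toℕ-injective; suc-injective; _≟_; all?; any?)
open import Data.Product using (Σ; _×_; _,_; proj₁; proj₂)
open import Data.Sum using (_⊎_; inj₁; inj₂; reduce)
open import Data.Bool using (true; false; T)
open import Data.Unit using (tt)
open import Data.Maybe using (just; nothing)
open import Data.Maybe.Properties using (just-injective)
open import Data.List using ([]; _∷_)
open import Data.List.Relation.Unary.Any using (here)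
open import Data.List.Membership.Propositional using (_∉_)
open import Data.Empty using (⊥; ⊥-elim)
open import Function using (flip)
open import Relation.Binary.Core using (Rel)
open import Relation.Binary.Definitions using (Transitive; Total)
open import Relation.Nullary using (¬_; Dec; yes; no)
open import Relation.Nullary.Decidable using (map′; ¬?; _×-dec_; _→-dec_)
open import Relation.Unary using (Pred; Decidable)
open import Relation.Binary.PropositionalEquality using (_≡_; _≢_; refl; sym; trans; cong; subst; ≢-sym)

least : ∀ {a ℓ p} {A : Set a} {_≲_ : Rel A ℓ} → Transitive _≲_ → Total _≲_ →
        ∀ {n} {P : Pred (Fin n) p} → Decidable P → (f : Fin n → A) →
        (∀ j → ¬ P j) ⊎ Σ (Fin n) λ j → P j × (∀ j' → P j' → f j ≲ f j')
least ≲-trans ≲-total {zero} P? f = inj₁ λ ()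
least ≲-trans ≲-total {suc n} P? f
  with least ≲-trans ≲-total (λ j → P? (suc j)) (λ j → f (suc j)) | P? zero
... | inj₁ none | no ¬p₀ = inj₁ λ { zero → ¬p₀ ; (suc j) → none j }
... | inj₁ none | yes p₀ =
  inj₂ (zero , p₀ , λ { zero _ → reduce (≲-total (f zero) (f zero)) ; (suc j) pj → ⊥-elim (none j pj) })
... | inj₂ (j , pj , min) | no ¬p₀ =
  inj₂ (suc j , pj , λ { zero p₀ → ⊥-elim (¬p₀ p₀) ; (suc j') → min j' })
... | inj₂ (j , pj , min) | yes p₀ with ≲-total (f zero) (f (suc j))
...   | inj₁ f₀≲ = inj₂ (zero , p₀ , λ { zero _ → reduce (≲-total (f zero) (f zero))
                                        ; (suc j') pj' → ≲-trans f₀≲ (min j' pj') })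
...   | inj₂ ≲f₀ = inj₂ (suc j , pj , λ { zero _ → ≲f₀ ; (suc j') → min j' })

module _ {k : ℕ} {par : Fin k → Fin (suc k)} where
  private
    _⊑_ : Fin (suc k) → Fin (suc k) → Set
    _⊑_ = Anc par

  Anc-trans : ∀ {a b c} → a ⊑ b → b ⊑ c → a ⊑ c
  Anc-trans p refl = p
  Anc-trans p (up q) = up (Anc-trans p q)

  Anc-comparable : ∀ {a b c} → a ⊑ c → b ⊑ c → a ⊑ b ⊎ b ⊑ a
  Anc-comparable refl q = inj₂ q
  Anc-comparable (up p) refl = inj₁ (up p)
  Anc-comparable (up p) (up q) = Anc-comparable p q

  Anc-parent : ∀ {a i} → a ⊑ suc i → a ≢ suc i → a ⊑ par i
  Anc-parent refl a≢a = ⊥-elim (a≢a refl)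
  Anc-parent (up p) _ = p

  Anc-zero : ∀ {a} → a ⊑ zero → a ≡ zero
  Anc-zero refl = refl

module DecreasingParents {k : ℕ} {par : Fin k → Fin (suc k)}
                         (par≤ : ∀ i → toℕ (par i) ≤ toℕ i) where
  private
    _⊑_ : Fin (suc k) → Fin (suc k) → Set
    _⊑_ = Anc par

  Anc⇒≤ : ∀ {a b} → a ⊑ b → toℕ a ≤ toℕ b
  Anc⇒≤ refl = ≤-refl
  Anc⇒≤ (up {i} p) = ≤-trans (Anc⇒≤ p) (≤-trans (par≤ i) (n≤1+n (toℕ i)))


  Anc-antisym : ∀ {a b} → a ⊑ b → b ⊑ a → a ≡ b
  Anc-antisym p q = toℕ-injective (≤-antisym (Anc⇒≤ p) (Anc⇒≤ q))

  Anc⇒< : ∀ {a b} → a ⊑ b → a ≢ b → toℕ a < toℕ b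
  Anc⇒< p a≢b = ≤∧≢⇒< (Anc⇒≤ p) (λ eq → a≢b (toℕ-injective eq))

  parent-rec : ∀ {ℓ} (P : Fin (suc k) → Set ℓ) → P zero → (∀ i → P (par i) → P (suc i)) →
               ∀ b → P b
  parent-rec P p₀ step b = go (toℕ b) b ≤-refl
    where
    go : ∀ n b → toℕ b ≤ n → P b
    go _ zero _ = p₀
    go (suc n) (suc i) (s≤s i≤n) = step i (go n (par i) (≤-trans (par≤ i) i≤n))

  zero-Anc : ∀ b → zero ⊑ b
  zero-Anc = parent-rec (zero ⊑_) refl (λ _ → up)

  Anc? : ∀ a b → Dec (a ⊑ b)
  Anc? a = parent-rec (λ b → Dec (a ⊑ b)) (map′ (λ { refl → refl }) Anc-zero (a ≟ zero)) step
    where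
    step : ∀ i → Dec (a ⊑ par i) → Dec (a ⊑ suc i)
    step i a⊑par? with a ≟ suc i
    ... | yes refl = yes refl
    ... | no a≢i = map′ up (λ p → Anc-parent p a≢i) a⊑par?

module _ {k m : ℕ} {E : Edges k m} (tr : DFSTree E) where
  open DFSTree tr
  open DecreasingParents parent<

  private
    _⊑_ : V tr → V tr → Set
    _⊑_ = _≼_ tr

  Endpoints : Fin m → V tr → V tr → Set
  Endpoints j a b = E j ≡ (a , b) ⊎ E j ≡ (b , a)

  endpoints-unique : ∀ {j a b s t} → Endpoints j a b → Endpoints j s t →
                     (a ≡ s × b ≡ t) ⊎ (a ≡ t × b ≡ s)
  endpoints-unique (inj₁ p) (inj₁ q) with trans (sym p) q
  ... | refl = inj₁ (refl , refl)
  endpoints-unique (inj₁ p) (inj₂ q) with trans (sym p) q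
  ... | refl = inj₂ (refl , refl)
  endpoints-unique (inj₂ p) (inj₁ q) with trans (sym p) q
  ... | refl = inj₂ (refl , refl)
  endpoints-unique (inj₂ p) (inj₂ q) with trans (sym p) q
  ... | refl = inj₁ (refl , refl)

  endpoints-x-y : ∀ j → Endpoints j (x tr j) (y tr j)
  endpoints-x-y j with toℕ (proj₁ (E j)) ≤ᵇ toℕ (proj₂ (E j))
  ... | true = inj₂ refl
  ... | false = inj₁ refl

  y≼x : ∀ {j} → IsBack tr j → y tr j ⊑ x tr j
  y≼x {j} back with toℕ (proj₁ (E j)) ≤ᵇ toℕ (proj₂ (E j)) in ≤ᵇ≡ | back-anc j back
  ... | true  | inj₁ p₁⊑p₂ = p₁⊑p₂
  ... | true  | inj₂ p₂⊑p₁ = subst (proj₁ (E j) ⊑_) p₁≡p₂ refl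
    where
    p₁≡p₂ : proj₁ (E j) ≡ proj₂ (E j)
    p₁≡p₂ = toℕ-injective (≤-antisym (≤ᵇ⇒≤ _ _ (subst T (sym ≤ᵇ≡) tt)) (Anc⇒≤ p₂⊑p₁))
  ... | false | inj₁ p₁⊑p₂ = ⊥-elim (subst T ≤ᵇ≡ (≤⇒≤ᵇ (Anc⇒≤ p₁⊑p₂)))
  ... | false | inj₂ p₂⊑p₁ = p₂⊑p₁

  InB-descend : ∀ {w t j} → InB tr w j → w ⊑ t → t ⊑ x tr j → InB tr t j
  InB-descend (back , _ , y⊑w , y≢w) w⊑t t⊑x =
    back , t⊑x , Anc-trans y⊑w w⊑t ,
    λ y≡t → y≢w (trans y≡t (Anc-antisym (subst (_⊑ _) y≡t y⊑w) w⊑t))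

  child⋠parent : ∀ {c a} → Child tr c a → ¬ (c ⊑ a)
  child⋠parent (i , refl , refl) c⊑a = 1+n≰n (≤-trans (Anc⇒≤ c⊑a) (parent< i))

  parent≼child : ∀ {c a} → Child tr c a → a ⊑ c
  parent≼child (i , refl , refl) = up refl

  child≢zero : ∀ {c a} → Child tr c a → c ≢ zero
  child≢zero (i , refl , refl) ()

  InB-child⇒y≼parent : ∀ {c a j} → Child tr c a → InB tr c j → y tr j ⊑ a
  InB-child⇒y≼parent (i , refl , refl) (_ , _ , y⊑c , y≢c) = Anc-parent y⊑c y≢c

  child-toward : ∀ {a b} → a ⊑ b → a ≢ b → Σ (V tr) λ c → Child tr c a × c ⊑ b
  child-toward refl a≢a = ⊥-elim (a≢a refl)
  child-toward {a} (up {i} a⊑par) a≢b with a ≟ parent i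
  ... | yes refl = suc i , (i , refl , refl) , refl
  ... | no a≢par with child-toward a⊑par a≢par
  ...   | c , c-child , c⊑par = c , c-child , up c⊑par

  sibling-descendant⇒≡ : ∀ {c d a} → Child tr c a → Child tr d a → c ⊑ d → c ≡ d
  sibling-descendant⇒≡ {c} c-child (i , refl , refl) c⊑d with c ≟ suc i
  ... | yes c≡d = c≡d
  ... | no c≢d = ⊥-elim (child⋠parent c-child (Anc-parent c⊑d c≢d))

  children-disjoint : ∀ {c d a z} → Child tr c a → Child tr d a → c ⊑ z → d ⊑ z → c ≡ d
  children-disjoint c-child d-child c⊑z d⊑z with Anc-comparable c⊑z d⊑z
  ... | inj₁ c⊑d = sibling-descendant⇒≡ c-child d-child c⊑d
  ... | inj₂ d⊑c = sym (sibling-descendant⇒≡ d-child c-child d⊑c)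

  IsNCA-cong : ∀ {S S' : V tr → Set} {z} → (∀ a → S a → S' a) → (∀ a → S' a → S a) →
               IsNCA tr S z → IsNCA tr S' z
  IsNCA-cong to from ((a , sa) , below , greatest) =
    (a , to a sa) , (λ a s → below a (from a s)) , λ z' h → greatest z' (λ a s → h a (to a s))

  IsNCA-singleton : ∀ {S : V tr → Set} {z} → S z → (∀ a → S a → a ≡ z) → IsNCA tr S z
  IsNCA-singleton sz only = (_ , sz) , (λ a s → subst (_ ⊑_) (sym (only a s)) refl) , λ z' h → h _ sz

  -- The nca is found as the deepest common ancestor, i.e. the one with the largest number.
  nca-exists : ∀ {n} {P : Fin n → Set} → Decidable P → (f : Fin n → V tr) → Σ (Fin n) P →
               Σ (V tr) (IsNCA tr (λ a → Σ (Fin n) λ j → P j × f j ≡ a))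
  nca-exists {P = P} P? f (j₀ , pj₀)
    with least (flip ≤-trans) (flip ≤-total) (λ z → all? (λ j → P? j →-dec Anc? z (f j))) toℕ
  ... | inj₁ none = ⊥-elim (none zero (λ j _ → zero-Anc (f j)))
  ... | inj₂ (z , common , deepest) =
    z , (f j₀ , j₀ , pj₀ , refl) , (λ { a (j , pj , refl) → common j pj }) , greatest
    where
    greatest : ∀ z' → (∀ a → (Σ _ λ j → P j × f j ≡ a) → z' ⊑ a) → z' ⊑ z
    greatest z' h with Anc-comparable (h (f j₀) (j₀ , pj₀ , refl)) (common j₀ pj₀)
    ... | inj₁ z'⊑z = z'⊑z
    ... | inj₂ z⊑z' = subst (_⊑ z) z≡z' refl
      where
      z≡z' : z ≡ z'
      z≡z' = toℕ-injective (≤-antisym (Anc⇒≤ z⊑z') (deepest z' λ j pj → h (f j) (j , pj , refl)))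

  IsBack? : ∀ j → Dec (IsBack tr j)
  IsBack? j = all? (λ i → ¬? (tedge i ≟ j))

  InB? : ∀ w j → Dec (InB tr w j)
  InB? w j = IsBack? j ×-dec Anc? w (x tr j) ×-dec Anc? (y tr j) w ×-dec ¬? (y tr j ≟ w)

  M-exists : ∀ {w j} → InB tr w j → Σ (V tr) (IsM tr w)
  M-exists {w} {j} j∈B = nca-exists (InB? w) (x tr) (j , j∈B)

  ≼M : ∀ {w z} → IsM tr w z → w ⊑ z
  ≼M (_ , _ , greatest) = greatest _ λ { a (j , (_ , w⊑x , _) , refl) → w⊑x }

  M-antitone : ∀ {w w' z z'} → (∀ {j} → InB tr w j → InB tr w' j) →
               IsM tr w z → IsM tr w' z' → z' ⊑ z
  M-antitone B⊆B' (_ , _ , greatest) (_ , below' , _) =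
    greatest _ λ { a (j , j∈B , x≡a) → below' a (j , B⊆B' j∈B , x≡a) }

  module _ (i : Fin k) (B-empty : ∀ j → ¬ InB tr (suc i) j) where

    back-edge-closed : ∀ {j a b} → IsBack tr j → Endpoints j a b → suc i ⊑ a → suc i ⊑ b
    back-edge-closed {j} back ends w⊑a with endpoints-unique ends (endpoints-x-y j)
    ... | inj₂ (refl , refl) = Anc-trans w⊑a (y≼x back)
    ... | inj₁ (refl , refl) with Anc-comparable w⊑a (y≼x back)
    ...   | inj₁ w⊑y = w⊑y
    ...   | inj₂ y⊑w with y tr j ≟ suc i
    ...     | yes y≡w = subst (suc i ⊑_) (sym y≡w) refl
    ...     | no y≢w = ⊥-elim (B-empty j (back , w⊑a , y⊑w , y≢w))

    edge-closed : ∀ {j a b} → j ≢ tedge i → Endpoints j a b → suc i ⊑ a → suc i ⊑ b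
    edge-closed {j} j≢tedge ends w⊑a with any? (λ i' → tedge i' ≟ j)
    ... | no not-tree = back-edge-closed (λ i' eq → not-tree (i' , eq)) ends w⊑a
    ... | yes (i' , refl) with endpoints-unique ends (tedge-end i')
    ...   | inj₁ (refl , refl) = Anc-parent w⊑a λ eq → j≢tedge (cong tedge (sym (suc-injective eq)))
    ...   | inj₂ (refl , refl) = up w⊑a

    reach⇒descendant : ∀ {b} → Reach E (λ j → j ∉ tedge i ∷ []) (suc i) b → suc i ⊑ b
    reach⇒descendant here = refl
    reach⇒descendant (fwd j j∉ r) = edge-closed (λ eq → j∉ (here eq)) (inj₁ refl) (reach⇒descendant r)
    reach⇒descendant (bwd j j∉ r) = edge-closed (λ eq → j∉ (here eq)) (inj₂ refl) (reach⇒descendant r)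

  low1-exists : ThreeEdgeConnected E → ∀ {w} → w ≢ zero → Σ (V tr) (IsLow1 tr w)
  low1-exists tec {zero} w≢zero = ⊥-elim (w≢zero refl)
  low1-exists tec {suc i} _ with least ≤-trans ≤-total (InB? (suc i)) (λ j → toℕ (y tr j))
  ... | inj₂ (j , j∈B , minimal) = y tr j , (j , j∈B , refl) , minimal
  ... | inj₁ B-empty with Anc-zero (reach⇒descendant i B-empty (tec (tedge i ∷ []) (s≤s z≤n) (suc i) zero))
  ...   | ()

  module _ (ord : ChildOrder tr) where
    open ChildOrder ord

    Low1Below : ℕ → V tr → Set
    Low1Below n t = Σ (V tr) λ l → IsLow1 tr t l × toℕ l < n

    module _ {w c c' : V tr} {n : ℕ}
             (others-high : ∀ d → Child tr d w → d ≢ c → d ≢ c' →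
                            Σ (V tr) λ l → IsLow1 tr d l × n ≤ toℕ l)
             where
      private
        Among : V tr → Set
        Among d = d ≡ c ⊎ d ≡ c'

        among : ∀ {d t} → Child tr d w → Low1≤ tr d t → Low1Below n t → Among d
        among {d} d-child d≤t (lt , t-low , lt<n) with d ≟ c | d ≟ c'
        ... | yes d≡c | _ = inj₁ d≡c
        ... | no _ | yes d≡c' = inj₂ d≡c'
        ... | no d≢c | no d≢c' with others-high d d-child d≢c d≢c'
        ...   | ld , d-low , n≤ld = ⊥-elim (<⇒≱ lt<n (≤-trans n≤ld (d≤t ld lt d-low t-low)))

        third-of-two : ∀ {p q r} → Among p → Among q → Among r → q ≢ r → p ≢ q → p ≡ r
        third-of-two (inj₁ refl) (inj₁ refl) _ _ p≢q = ⊥-elim (p≢q refl)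
        third-of-two (inj₂ refl) (inj₂ refl) _ _ p≢q = ⊥-elim (p≢q refl)
        third-of-two (inj₁ refl) (inj₂ refl) (inj₁ refl) _ _ = refl
        third-of-two (inj₁ refl) (inj₂ refl) (inj₂ refl) q≢r _ = ⊥-elim (q≢r refl)
        third-of-two (inj₂ refl) (inj₁ refl) (inj₁ refl) q≢r _ = ⊥-elim (q≢r refl)
        third-of-two (inj₂ refl) (inj₁ refl) (inj₂ refl) _ _ = refl

        second : ∀ {a b} → c₁ w ≡ just a → Among a → Child tr b w → Among b → a ≢ b → Low1Below n b →
                 c₂ w ≡ just b
        second {a} {b} c₁≡a a-among b-child b-among a≢b b-low with c₂ w in c₂≡
        ... | nothing = ⊥-elim (a≢b (sym (c₂-nothing w c₂≡ b a c₁≡a b-child)))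
        ... | just d₂ with c₂-just w d₂ c₂≡
        ...   | d₂-child , d , c₁≡d , d₂≢d , d₂≤ with just-injective (trans (sym c₁≡d) c₁≡a)
        ...     | refl = cong just (third-of-two (among d₂-child (d₂≤ b b-child (≢-sym a≢b)) b-low)
                                                  a-among b-among a≢b d₂≢d)

      first-two-children : Child tr c w → Child tr c' w → c ≢ c' → Low1Below n c → Low1Below n c' →
                           (c₁ w ≡ just c × c₂ w ≡ just c') ⊎ (c₁ w ≡ just c' × c₂ w ≡ just c)
      first-two-children c-child c'-child c≢c' c-low c'-low with c₁ w in c₁≡
      ... | nothing = ⊥-elim (c₁-nothing w c₁≡ c c-child)
      ... | just d₁ with among (proj₁ (c₁-just w d₁ c₁≡)) (proj₂ (c₁-just w d₁ c₁≡) c c-child) c-low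
      ...   | inj₁ refl = inj₁ (refl , second c₁≡ (inj₁ refl) c'-child (inj₂ refl) c≢c' c'-low)
      ...   | inj₂ refl = inj₂ (refl , second c₁≡ (inj₂ refl) c-child (inj₁ refl) (≢-sym c≢c') c-low)

    Alternatives : V tr → Fin m → V tr → Set
    Alternatives v e Mu =
        (IsMt tr v Mu × Σ (V tr) λ Mv → IsM tr v Mv × x tr e ≡ Mv × IsL1 tr Mv (y tr e))
      ⊎ (IsMlow1 tr ord v Mu × Σ (V tr) λ M₂ → IsMlow2 tr ord v M₂ × x tr e ≡ M₂ × IsL1 tr M₂ (y tr e))
      ⊎ (IsMlow2 tr ord v Mu × Σ (V tr) λ M₁ → IsMlow1 tr ord v M₁ × x tr e ≡ M₁ × IsL1 tr M₁ (y tr e))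

    module BvSplit (tec : ThreeEdgeConnected E) {u v : V tr} {e : Fin m} (v⊑u : v ⊑ u)
                   (Bv⇒ : ∀ j → InB tr v j → InB tr u j ⊎ j ≡ e)
                   (⇒Bv : ∀ j → InB tr u j ⊎ j ≡ e → InB tr v j)
                   (e∉Bu : ¬ InB tr u e) where

      Bv-elim : (P : Fin m → Set) → (∀ {j} → InB tr u j → P j) → P e → ∀ {j} → InB tr v j → P j
      Bv-elim P on-Bu on-e {j} j∈Bv with Bv⇒ j j∈Bv
      ... | inj₁ j∈Bu = on-Bu j∈Bu
      ... | inj₂ refl = on-e

      Bu⊆Bv : ∀ {j} → InB tr u j → InB tr v j
      Bu⊆Bv j∈Bu = ⇒Bv _ (inj₁ j∈Bu)

      e∈Bv : InB tr v e
      e∈Bv = ⇒Bv e (inj₂ refl)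

      xe ye : V tr
      xe = x tr e
      ye = y tr e

      v⊑xe : v ⊑ xe
      v⊑xe = proj₁ (proj₂ e∈Bv)

      ye⊑v : ye ⊑ v
      ye⊑v = proj₁ (proj₂ (proj₂ e∈Bv))

      ye≢v : ye ≢ v
      ye≢v = proj₂ (proj₂ (proj₂ e∈Bv))

      u⋠xe : ¬ (u ⊑ xe)
      u⋠xe u⊑xe = e∉Bu (InB-descend e∈Bv v⊑u u⊑xe)

      u≢zero : u ≢ zero
      u≢zero refl = u⋠xe (zero-Anc xe)

      Bu-has-M : Σ (V tr) (IsM tr u)
      Bu-has-M with low1-exists tec u≢zero
      ... | _ , (_ , j∈Bu , _) , _ = M-exists j∈Bu

      l₁-xe : IsL1 tr xe ye
      l₁-xe = inj₁ (e , proj₁ e∈Bv , refl , refl , minimal)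
        where
        minimal : ∀ j → IsBack tr j → x tr j ≡ xe → toℕ ye ≤ toℕ (y tr j)
        minimal j back x≡xe with Anc-comparable (subst (y tr j ⊑_) x≡xe (y≼x back)) (y≼x (proj₁ e∈Bv))
        ... | inj₂ ye⊑y = Anc⇒≤ ye⊑y
        ... | inj₁ y⊑ye = Bv-elim (λ j → x tr j ≡ xe → toℕ ye ≤ toℕ (y tr j))
                                  (λ j∈Bu x≡xe → ⊥-elim (u⋠xe (subst (u ⊑_) x≡xe (proj₁ (proj₂ j∈Bu)))))
                                  (λ _ → ≤-refl) j∈Bv x≡xe
          where
          j∈Bv : InB tr v j
          j∈Bv = back , subst (v ⊑_) (sym x≡xe) v⊑xe , Anc-trans y⊑ye ye⊑v ,
                 λ y≡v → ye≢v (Anc-antisym ye⊑v (subst (_⊑ ye) y≡v y⊑ye))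

      module _ {Mu Mv : V tr} (Mu-is : IsM tr u Mu) (Mv-is : IsM tr v Mv) where

        Mu⊑x : ∀ {j} → InB tr u j → Mu ⊑ x tr j
        Mu⊑x {j} j∈Bu = proj₁ (proj₂ Mu-is) (x tr j) (j , j∈Bu , refl)

        Mv⊑xe : Mv ⊑ xe
        Mv⊑xe = proj₁ (proj₂ Mv-is) xe (e , e∈Bv , refl)

        v⊑Mv : v ⊑ Mv
        v⊑Mv = ≼M Mv-is

        Mv⊑Mu : Mv ⊑ Mu
        Mv⊑Mu = M-antitone Bu⊆Bv Mu-is Mv-is

        Mu≢Mv : Mu ≢ Mv
        Mu≢Mv Mu≡Mv = u⋠xe (Anc-trans (≼M Mu-is) (subst (_⊑ xe) (sym Mu≡Mv) Mv⊑xe))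

        common⇒⊑Mv : ∀ {z} → z ⊑ Mu → z ⊑ xe → z ⊑ Mv
        common⇒⊑Mv {z} z⊑Mu z⊑xe = proj₂ (proj₂ Mv-is) z λ { a (j , j∈Bv , refl) →
          Bv-elim (λ j → z ⊑ x tr j) (λ j∈Bu → Anc-trans z⊑Mu (Mu⊑x j∈Bu)) z⊑xe j∈Bv }

        Mu-is-M̃v : Mv ≡ xe → IsMt tr v Mu
        Mu-is-M̃v Mv≡xe = Mv , Mv-is , IsNCA-cong to from Mu-is
          where
          to : ∀ a → (Σ (Fin m) λ j → InB tr u j × x tr j ≡ a) →
               Σ (Fin m) λ j → InB tr v j × x tr j ≡ a × Mv ⊑ a × a ≢ Mv
          to a (j , j∈Bu , refl) =
            j , Bu⊆Bv j∈Bu , refl , Anc-trans Mv⊑Mu (Mu⊑x j∈Bu) ,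
            λ x≡Mv → Mu≢Mv (Anc-antisym (subst (Mu ⊑_) x≡Mv (Mu⊑x j∈Bu)) Mv⊑Mu)
          from : ∀ a → (Σ (Fin m) λ j → InB tr v j × x tr j ≡ a × Mv ⊑ a × a ≢ Mv) →
                 Σ (Fin m) λ j → InB tr u j × x tr j ≡ a
          from a (j , j∈Bv , refl , _ , x≢Mv) =
            Bv-elim (λ j → x tr j ≢ Mv → Σ (Fin m) λ j' → InB tr u j' × x tr j' ≡ x tr j)
                    (λ j∈Bu _ → _ , j∈Bu , refl) (λ xe≢Mv → ⊥-elim (xe≢Mv (sym Mv≡xe))) j∈Bv x≢Mv

        module _ (Mv≢xe : Mv ≢ xe) where
          private
            c-spec : Σ (V tr) λ c → Child tr c Mv × c ⊑ Mu
            c-spec = child-toward Mv⊑Mu (≢-sym Mu≢Mv)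

            c'-spec : Σ (V tr) λ c' → Child tr c' Mv × c' ⊑ xe
            c'-spec = child-toward Mv⊑xe Mv≢xe

          c c' : V tr
          c = proj₁ c-spec
          c' = proj₁ c'-spec

          c-child : Child tr c Mv
          c-child = proj₁ (proj₂ c-spec)

          c'-child : Child tr c' Mv
          c'-child = proj₁ (proj₂ c'-spec)

          c⊑Mu : c ⊑ Mu
          c⊑Mu = proj₂ (proj₂ c-spec)

          c'⊑xe : c' ⊑ xe
          c'⊑xe = proj₂ (proj₂ c'-spec)

          c⊑x : ∀ {j} → InB tr u j → c ⊑ x tr j
          c⊑x j∈Bu = Anc-trans c⊑Mu (Mu⊑x j∈Bu)

          c≢c' : c ≢ c'
          c≢c' c≡c' = child⋠parent c-child (common⇒⊑Mv c⊑Mu (subst (_⊑ xe) (sym c≡c') c'⊑xe))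

          TipsBelow : V tr → V tr → Set
          TipsBelow t a = Σ (Fin m) λ j → InB tr v j × x tr j ≡ a × t ⊑ a

          Mu-is-nca-below-c : IsNCA tr (TipsBelow c) Mu
          Mu-is-nca-below-c = IsNCA-cong to from Mu-is
            where
            to : ∀ a → (Σ (Fin m) λ j → InB tr u j × x tr j ≡ a) → TipsBelow c a
            to a (j , j∈Bu , refl) = j , Bu⊆Bv j∈Bu , refl , c⊑x j∈Bu
            from : ∀ a → TipsBelow c a → Σ (Fin m) λ j → InB tr u j × x tr j ≡ a
            from a (j , j∈Bv , refl , c⊑x') =
              Bv-elim (λ j → c ⊑ x tr j → Σ (Fin m) λ j' → InB tr u j' × x tr j' ≡ x tr j)
                      (λ j∈Bu _ → _ , j∈Bu , refl)
                      (λ c⊑xe → ⊥-elim (c≢c' (children-disjoint c-child c'-child c⊑xe c'⊑xe))) j∈Bv c⊑x'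

          xe-is-nca-below-c' : IsNCA tr (TipsBelow c') xe
          xe-is-nca-below-c' = IsNCA-singleton (e , e∈Bv , refl , c'⊑xe) only
            where
            only : ∀ a → TipsBelow c' a → a ≡ xe
            only a (j , j∈Bv , refl , c'⊑x) =
              Bv-elim (λ j → c' ⊑ x tr j → x tr j ≡ xe)
                      (λ j∈Bu c'⊑x → ⊥-elim (c≢c' (children-disjoint c-child c'-child (c⊑x j∈Bu) c'⊑x)))
                      (λ _ → refl) j∈Bv c'⊑x

          low1-below-v : ∀ {t j} → Child tr t Mv → InB tr v j → t ⊑ x tr j → Low1Below (toℕ v) t
          low1-below-v {t} {j} t-child j∈Bv@(_ , _ , y⊑v , y≢v) t⊑x with low1-exists tec (child≢zero t-child)
          ... | l , t-low@(_ , minimal) = l , t-low , ≤-<-trans (minimal j j∈Bt) (Anc⇒< y⊑v y≢v)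
            where
            j∈Bt : InB tr t j
            j∈Bt = InB-descend j∈Bv (Anc-trans v⊑Mv (parent≼child t-child)) t⊑x

          others-high : ∀ d → Child tr d Mv → d ≢ c → d ≢ c' →
                        Σ (V tr) λ l → IsLow1 tr d l × toℕ v ≤ toℕ l
          others-high d d-child d≢c d≢c' with low1-exists tec (child≢zero d-child)
          ... | l , d-low@((j , j∈Bd@(back , d⊑x , _) , refl) , _) = l , d-low , v≤y
            where
            v≤y : toℕ v ≤ toℕ (y tr j)
            v≤y with Anc-comparable v⊑Mv (InB-child⇒y≼parent d-child j∈Bd)
            ... | inj₁ v⊑y = Anc⇒≤ v⊑y
            ... | inj₂ y⊑v with y tr j ≟ v
            ...   | yes refl = ≤-refl
            ...   | no y≢v =
              ⊥-elim (Bv-elim (λ j → d ⊑ x tr j → ⊥)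
                              (λ j∈Bu d⊑x → d≢c (children-disjoint d-child c-child d⊑x (c⊑x j∈Bu)))
                              (λ d⊑xe → d≢c' (children-disjoint d-child c'-child d⊑xe c'⊑xe))
                              (back , Anc-trans v⊑Mv (Anc-trans (parent≼child d-child) d⊑x) , y⊑v , y≢v)
                              d⊑x)

          c-c'-first-two : (c₁ Mv ≡ just c × c₂ Mv ≡ just c') ⊎ (c₁ Mv ≡ just c' × c₂ Mv ≡ just c)
          c-c'-first-two with proj₁ Mu-is
          ... | _ , j , j∈Bu , _ =
            first-two-children others-high c-child c'-child c≢c'
              (low1-below-v c-child (Bu⊆Bv j∈Bu) (c⊑x j∈Bu)) (low1-below-v c'-child e∈Bv c'⊑xe)

        alternatives : Alternatives v e Mu
        alternatives with Mv ≟ xe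
        ... | yes Mv≡xe =
          inj₁ (Mu-is-M̃v Mv≡xe , Mv , Mv-is , sym Mv≡xe , subst (λ t → IsL1 tr t ye) (sym Mv≡xe) l₁-xe)
        ... | no Mv≢xe with c-c'-first-two Mv≢xe
        ...   | inj₁ (c₁≡c , c₂≡c') =
          inj₂ (inj₁ ((Mv , c Mv≢xe , Mv-is , c₁≡c , Mu-is-nca-below-c Mv≢xe) ,
                      xe , (Mv , c' Mv≢xe , Mv-is , c₂≡c' , xe-is-nca-below-c' Mv≢xe) , refl , l₁-xe))
        ...   | inj₂ (c₁≡c' , c₂≡c) =
          inj₂ (inj₂ ((Mv , c Mv≢xe , Mv-is , c₂≡c , Mu-is-nca-below-c Mv≢xe) ,
                      xe , (Mv , c' Mv≢xe , Mv-is , c₁≡c' , xe-is-nca-below-c' Mv≢xe) , refl , l₁-xe))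

lemma2 : {k m : ℕ} (E : Edges k m) → ThreeEdgeConnected E →
  (tr : DFSTree E) (ord : ChildOrder tr) (u v : Fin (suc k)) (e : Fin m) →
  _≼_ tr v u →
  (∀ j → InB tr v j → InB tr u j ⊎ j ≡ e) →
  (∀ j → InB tr u j ⊎ j ≡ e → InB tr v j) →
  ¬ InB tr u e →
  Σ (Fin (suc k)) λ Mu → IsM tr u Mu ×
    ((IsMt tr v Mu × Σ (Fin (suc k)) λ Mv → IsM tr v Mv × x tr e ≡ Mv × IsL1 tr Mv (y tr e))
    ⊎ (IsMlow1 tr ord v Mu × Σ (Fin (suc k)) λ M2 → IsMlow2 tr ord v M2 × x tr e ≡ M2 × IsL1 tr M2 (y tr e))
    ⊎ (IsMlow2 tr ord v Mu × Σ (Fin (suc k)) λ M1 → IsMlow1 tr ord v M1 × x tr e ≡ M1 × IsL1 tr M1 (y tr e)))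
lemma2 E tec tr ord u v e v⊑u Bv⇒ ⇒Bv e∉Bu =
  let open BvSplit tr ord tec v⊑u Bv⇒ ⇒Bv e∉Bu
      (Mu , Mu-is) = Bu-has-M
      (_ , Mv-is) = M-exists tr e∈Bv
  in Mu , Mu-is , alternatives Mu-is Mv-is
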